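{- For every integer $n\ge 0$, \[ \sum_{k=0}^{\lfloor n/2\rfloor}\binom{n+k}{n}^2\binom{2n+k}{n}\binom{3n+1}{n-2k}=\binom{2n}{n}^3. \]
   Context: $\binom{m}{j}$ is the usual binomial coefficient for integers $m\ge0$, with $\binom{m}{j}=0$ if $j<0$ or $j>m$. -}

module Defs where

open import Data.Nat using (ℕ; zero; suc; _+_)

sumTo : ℕ → (ℕ → ℕ) → ℕ
sumTo zero f = f zero
sumTo (suc m) f = sumTo m f + f (suc m)

module Submission where

-- Creative telescoping. Write F(n,k) for the summand and S(n) for the sum. With
--   G(n,k) = q(n,k) (2n+2k+2)(2n+2k+3) C(n+k,n+1)² C(2n+k,n) C(3n+4,n+1-2k)
-- and κ(n) = 3(3n+2)(3n+4)(n+1) one has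
--   κ(n) ((n+1)³ F(n+1,k) - 8(2n+1)³ F(n,k)) = G(n,k) - G(n,k+1),
-- which after dividing by a², b, y (the shifted binomials being rational multiples of
-- a = C(n+k,n), b = C(2n+k,n), y = C(3n+4,n+1-2k)) is a polynomial identity. Summing over k,
-- G vanishes at k = 0 and at k = n+2, so (n+1)³ S(n+1) = 8(2n+1)³ S(n). Since
-- (n+1) C(2n+2,n+1) = 2(2n+1) C(2n,n), the cube C(2n,n)³ satisfies the same first-order
-- recurrence, and both sides equal 1 at n = 0.

open import Data.Nat as ℕ using (ℕ; zero; suc; _≤_; _<_; z≤n; s≤s)
import Data.Nat.Properties as ℕ
open import Data.Nat.DivMod using (m≡m%n+[m/n]*n; m%n<n; m/n*n≤m; m/n≤m)
open import Data.Nat.Combinatorics using (_C_; nC1≡n; nCk+nC[k+1]≡[n+1]C[k+1]; k>n⇒nCk≡0)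
import Data.Nat.Tactic.RingSolver as ℕ-Solver
open import Data.Integer using (ℤ; +_; -[1+_]; 0ℤ; 1ℤ; _+_; _*_; _-_; -_; _⊖_; NonZero)
open import Data.Integer.Properties
  using (pos-*; *-assoc; *-zeroˡ; *-zeroʳ; +-identityʳ; *-cancelˡ-≡; *-cancelʳ-≡; i-j≡0⇒i≡j; +-injective;
         i*j≢0; m-n≡m⊖n; ⊖-≥; ⊖-<)
import Data.Integer.Tactic.RingSolver as ℤ-Solver
open import Data.Sum using (inj₁; inj₂)
open import Relation.Binary.PropositionalEquality
open import Defs

[1+k]*[1+n]C[1+k]≡[1+n]*nCk : ∀ n k → suc k ℕ.* (suc n C suc k) ≡ suc n ℕ.* (n C k)
[1+k]*[1+n]C[1+k]≡[1+n]*nCk zero    zero    = refl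
[1+k]*[1+n]C[1+k]≡[1+n]*nCk zero    (suc k) = ℕ.*-zeroʳ (suc (suc k))
[1+k]*[1+n]C[1+k]≡[1+n]*nCk (suc n) zero    =
  trans (ℕ.*-identityˡ _) (trans (nC1≡n (suc (suc n))) (sym (ℕ.*-identityʳ (suc (suc n)))))
[1+k]*[1+n]C[1+k]≡[1+n]*nCk (suc n) (suc k) = begin
  suc (suc k) ℕ.* (suc m C suc (suc k))
    ≡⟨ cong (suc (suc k) ℕ.*_) (nCk+nC[k+1]≡[n+1]C[k+1] m (suc k)) ⟨
  suc (suc k) ℕ.* (m C suc k ℕ.+ m C suc (suc k))
    ≡⟨ split (suc k) (m C suc k) (m C suc (suc k)) ⟩
  suc k ℕ.* (m C suc k) ℕ.+ suc (suc k) ℕ.* (m C suc (suc k)) ℕ.+ m C suc k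
    ≡⟨ cong₂ (λ u v → u ℕ.+ v ℕ.+ m C suc k)
         ([1+k]*[1+n]C[1+k]≡[1+n]*nCk n k) ([1+k]*[1+n]C[1+k]≡[1+n]*nCk n (suc k)) ⟩
  m ℕ.* (n C k) ℕ.+ m ℕ.* (n C suc k) ℕ.+ m C suc k
    ≡⟨ cong (ℕ._+ m C suc k) (ℕ.*-distribˡ-+ m (n C k) (n C suc k)) ⟨
  m ℕ.* (n C k ℕ.+ n C suc k) ℕ.+ m C suc k
    ≡⟨ cong (λ u → m ℕ.* u ℕ.+ m C suc k) (nCk+nC[k+1]≡[n+1]C[k+1] n k) ⟩
  m ℕ.* (m C suc k) ℕ.+ m C suc k
    ≡⟨ ℕ.+-comm (m ℕ.* (m C suc k)) (m C suc k) ⟩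
  suc m ℕ.* (m C suc k) ∎
  where
    open ≡-Reasoning
    m = suc n
    split : ∀ j x y → suc j ℕ.* (x ℕ.+ y) ≡ j ℕ.* x ℕ.+ suc j ℕ.* y ℕ.+ x
    split = ℕ-Solver.solve-∀

[1+k]*nC[1+k]+k*nCk≡n*nCk : ∀ n k → suc k ℕ.* (n C suc k) ℕ.+ k ℕ.* (n C k) ≡ n ℕ.* (n C k)
[1+k]*nC[1+k]+k*nCk≡n*nCk n       zero    =
  trans (ℕ.+-identityʳ _) (trans (ℕ.*-identityˡ _) (trans (nC1≡n n) (sym (ℕ.*-identityʳ n))))
[1+k]*nC[1+k]+k*nCk≡n*nCk zero    (suc k) = cong₂ ℕ._+_ (ℕ.*-zeroʳ (suc (suc k))) (ℕ.*-zeroʳ (suc k))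
[1+k]*nC[1+k]+k*nCk≡n*nCk (suc n) (suc k) = begin
  suc (suc k) ℕ.* (suc n C suc (suc k)) ℕ.+ suc k ℕ.* (suc n C suc k)
    ≡⟨ cong₂ ℕ._+_ ([1+k]*[1+n]C[1+k]≡[1+n]*nCk n (suc k)) ([1+k]*[1+n]C[1+k]≡[1+n]*nCk n k) ⟩
  suc n ℕ.* (n C suc k) ℕ.+ suc n ℕ.* (n C k)
    ≡⟨ ℕ.*-distribˡ-+ (suc n) (n C suc k) (n C k) ⟨
  suc n ℕ.* (n C suc k ℕ.+ n C k)
    ≡⟨ cong (suc n ℕ.*_) (trans (ℕ.+-comm (n C suc k) (n C k)) (nCk+nC[k+1]≡[n+1]C[k+1] n k)) ⟩
  suc n ℕ.* (suc n C suc k) ∎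
  where open ≡-Reasoning

[1+n]*nCk+k*[1+n]Ck≡[1+n]*[1+n]Ck : ∀ n k → suc n ℕ.* (n C k) ℕ.+ k ℕ.* (suc n C k) ≡ suc n ℕ.* (suc n C k)
[1+n]*nCk+k*[1+n]Ck≡[1+n]*[1+n]Ck n zero    = ℕ.+-identityʳ _
[1+n]*nCk+k*[1+n]Ck≡[1+n]*[1+n]Ck n (suc k) = begin
  suc n ℕ.* (n C suc k) ℕ.+ suc k ℕ.* (suc n C suc k)
    ≡⟨ cong (suc n ℕ.* (n C suc k) ℕ.+_) ([1+k]*[1+n]C[1+k]≡[1+n]*nCk n k) ⟩
  suc n ℕ.* (n C suc k) ℕ.+ suc n ℕ.* (n C k)
    ≡⟨ ℕ.*-distribˡ-+ (suc n) (n C suc k) (n C k) ⟨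
  suc n ℕ.* (n C suc k ℕ.+ n C k)
    ≡⟨ cong (suc n ℕ.*_) (trans (ℕ.+-comm (n C suc k) (n C k)) (nCk+nC[k+1]≡[n+1]C[k+1] n k)) ⟩
  suc n ℕ.* (suc n C suc k) ∎
  where open ≡-Reasoning

linear⇒ratio : ∀ s x j y m → s ℕ.* x ℕ.+ j ℕ.* y ≡ m ℕ.* y → + x * + s ≡ + y * (+ m - + j)
linear⇒ratio s x j y m eq = begin
  + x * + s                       ≡⟨ isolate (+ s) (+ x) (+ j) (+ y) ⟩
  + s * + x + + j * + y - + j * + y ≡⟨ cong (_- + j * + y) lifted ⟩
  + m * + y - + j * + y           ≡⟨ factor (+ m) (+ j) (+ y) ⟩
  + y * (+ m - + j)               ∎
  where
    open ≡-Reasoning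
    lifted : + s * + x + + j * + y ≡ + m * + y
    lifted = trans (sym (cong₂ _+_ (pos-* s x) (pos-* j y))) (trans (cong +_ eq) (pos-* m y))
    isolate : ∀ s x j y → x * s ≡ s * x + j * y - j * y
    isolate = ℤ-Solver.solve-∀
    factor : ∀ m j y → m * y - j * y ≡ y * (m - j)
    factor = ℤ-Solver.solve-∀

ratio-trans : ∀ x y z d e d′ e′ → x * d ≡ y * e → y * d′ ≡ z * e′ → x * (d * d′) ≡ z * (e * e′)
ratio-trans x y z d e d′ e′ xd≡ye yd′≡ze′ = begin
  x * (d * d′)  ≡⟨ *-assoc x d d′ ⟨
  x * d * d′    ≡⟨ cong (_* d′) xd≡ye ⟩
  y * e * d′    ≡⟨ swap y e d′ ⟩
  y * d′ * e    ≡⟨ cong (_* e) yd′≡ze′ ⟩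
  z * e′ * e    ≡⟨ swap′ z e′ e ⟩
  z * (e * e′)  ∎
  where
    open ≡-Reasoning
    swap : ∀ a b c → a * b * c ≡ a * c * b
    swap = ℤ-Solver.solve-∀
    swap′ : ∀ a b c → a * b * c ≡ a * (c * b)
    swap′ = ℤ-Solver.solve-∀

infix 8 _Cᶻ_

-- With a lower index in ℤ (and value 0 below 0) the summand vanishes for 2k > n without case
-- distinctions, and the shift relations below hold for every lower index.
_Cᶻ_ : ℕ → ℤ → ℤ
n Cᶻ (+ k)    = + (n C k)
n Cᶻ -[1+ _ ] = 0ℤ

Cᶻ-lower : ∀ m t → m Cᶻ (1ℤ + t) * (1ℤ + t) ≡ m Cᶻ t * (+ m - t)
Cᶻ-lower m (+ k)          = linear⇒ratio (suc k) (m C suc k) k (m C k) m ([1+k]*nC[1+k]+k*nCk≡n*nCk m k)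
Cᶻ-lower m -[1+ zero ]    = refl
Cᶻ-lower m -[1+ suc _ ]   = refl

Cᶻ-upper : ∀ m t → suc m Cᶻ t * (+ suc m - t) ≡ m Cᶻ t * + suc m
Cᶻ-upper m (+ k)        =
  sym (linear⇒ratio (suc m) (m C k) k (suc m C k) (suc m) ([1+n]*nCk+k*[1+n]Ck≡[1+n]*[1+n]Ck m k))
Cᶻ-upper m -[1+ _ ]     = refl

Cᶻ-absorb : ∀ m t → suc m Cᶻ (1ℤ + t) * (1ℤ + t) ≡ m Cᶻ t * + suc m
Cᶻ-absorb m t = trans (Cᶻ-lower (suc m) t) (Cᶻ-upper m t)

Cᶻ-negative : ∀ m {j} → 0 ℕ.< j → m Cᶻ (- + j) ≡ 0ℤ
Cᶻ-negative m {suc j} _ = refl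

Cᶻ-lower₂ : ∀ m t →
  m Cᶻ (1ℤ + (1ℤ + t)) * ((1ℤ + (1ℤ + t)) * (1ℤ + t)) ≡ m Cᶻ t * ((+ m - (1ℤ + t)) * (+ m - t))
Cᶻ-lower₂ m t = ratio-trans (m Cᶻ (1ℤ + (1ℤ + t))) (m Cᶻ (1ℤ + t)) (m Cᶻ t)
  (1ℤ + (1ℤ + t)) (+ m - (1ℤ + t)) (1ℤ + t) (+ m - t) (Cᶻ-lower m (1ℤ + t)) (Cᶻ-lower m t)

Cᶻ-upper₂ : ∀ m t →
  suc (suc m) Cᶻ t * ((+ suc (suc m) - t) * (+ suc m - t)) ≡ m Cᶻ t * (+ suc (suc m) * + suc m)
Cᶻ-upper₂ m t = ratio-trans (suc (suc m) Cᶻ t) (suc m Cᶻ t) (m Cᶻ t)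
  (+ suc (suc m) - t) (+ suc (suc m)) (+ suc m - t) (+ suc m) (Cᶻ-upper (suc m) t) (Cᶻ-upper m t)

Cᶻ-absorb-upper : ∀ m t →
  suc (suc m) Cᶻ (1ℤ + t) * ((1ℤ + t) * (+ suc m - t)) ≡ m Cᶻ t * (+ suc (suc m) * + suc m)
Cᶻ-absorb-upper m t = ratio-trans (suc (suc m) Cᶻ (1ℤ + t)) (suc m Cᶻ t) (m Cᶻ t)
  (1ℤ + t) (+ suc (suc m)) (+ suc m - t) (+ suc m) (Cᶻ-absorb (suc m) t) (Cᶻ-upper m t)

Cᶻ-absorb-upper₂ : ∀ m t →
  suc (suc (suc m)) Cᶻ (1ℤ + t) * ((1ℤ + t) * ((+ suc (suc m) - t) * (+ suc m - t)))
    ≡ m Cᶻ t * (+ suc (suc (suc m)) * (+ suc (suc m) * + suc m))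
Cᶻ-absorb-upper₂ m t = ratio-trans (suc (suc (suc m)) Cᶻ (1ℤ + t)) (suc (suc m) Cᶻ t) (m Cᶻ t)
  (1ℤ + t) (+ suc (suc (suc m))) ((+ suc (suc m) - t) * (+ suc m - t)) (+ suc (suc m) * + suc m)
  (Cᶻ-absorb (suc (suc m)) t) (Cᶻ-upper₂ m t)

cube : ℤ → ℤ
cube x = x * x * x

κ : ℤ → ℤ
κ N = + 3 * (+ 3 * N + + 2) * (+ 3 * N + + 4) * (1ℤ + N)

-- The numerator of the rational certificate found by Zeilberger's algorithm.
q : ℤ → ℤ → ℤ
q N K = + 22 + + 46 * K + + 125 * N + + 169 * N * K + + 258 * N * N + + 200 * N * N * K
  + + 229 * N * N * N + + 77 * N * N * N * K + + 74 * N * N * N * N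

-- Upper indices are written n * 2 and n * 3 so that those of F (suc n) k reduce to
-- suc (suc (n * 2 + k)) and suc (suc (suc (n * 3 + 1))).
F : ℕ → ℕ → ℤ
F n k = (n ℕ.+ k) Cᶻ (+ n) * (n ℕ.+ k) Cᶻ (+ n) * (n ℕ.* 2 ℕ.+ k) Cᶻ (+ n)
  * (n ℕ.* 3 ℕ.+ 1) Cᶻ (+ n - + 2 * + k)

G : ℕ → ℕ → ℤ
G n k = q (+ n) (+ k) * ((+ 2 * + n + + 2 * + k + + 2) * (+ 2 * + n + + 2 * + k + + 3))
  * ((n ℕ.+ k) Cᶻ (+ suc n) * (n ℕ.+ k) Cᶻ (+ suc n) * (n ℕ.* 2 ℕ.+ k) Cᶻ (+ n)
     * (suc n ℕ.* 3 ℕ.+ 1) Cᶻ (+ suc n - + 2 * + k))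

-- (lhs - rhs) (1 + n)³ (1 + n + k) for the identity of creative-telescoping, in which every binomial
-- at a shifted index enters only through its product with the denominator of its ratio to a, b or y
-- (the arguments s₁ … w₂), so that the shift relations can be substituted into it.
clearedDifference : (N K a b y Q₀ Q₁ s₁ s₀ r₁ r₂ w w₂ : ℤ) → ℤ
clearedDifference N K a b y Q₀ Q₁ s₁ s₀ r₁ r₂ w w₂ =
  κ N * cube (1ℤ + N) * s₁ * s₁ * r₁ * y
  - + 8 * cube (1ℤ + + 2 * N) * cube (1ℤ + N) * (1ℤ + N + K) * a * a * b * w
  - (Q₀ * ((+ 2 * N + + 2 * K + + 2) * (+ 2 * N + + 2 * K + + 3)) * (1ℤ + N) * (1ℤ + N + K) * s₀ * s₀ * b * y
     - Q₁ * (1ℤ + N) * s₁ * s₁ * r₂ * w₂)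

clear-denominators : ∀ N K a b y a₀ a₁ b₁ b₂ c c₂ Q₀ Q₁ →
  ((+ 3 * (+ 3 * N + + 2) * (+ 3 * N + + 4) * (1ℤ + N))
      * ((1ℤ + N) * (1ℤ + N) * (1ℤ + N) * (a₁ * a₁ * b₁ * y)
         - + 8 * ((1ℤ + + 2 * N) * (1ℤ + + 2 * N) * (1ℤ + + 2 * N)) * (a * a * b * c))
    - (Q₀ * ((+ 2 * N + + 2 * K + + 2) * (+ 2 * N + + 2 * K + + 3)) * (a₀ * a₀ * b * y)
       - Q₁ * ((+ 2 * N + + 2 * (1ℤ + K) + + 2) * (+ 2 * N + + 2 * (1ℤ + K) + + 3)) * (a₁ * a₁ * b₂ * c₂)))
    * ((1ℤ + N) * (1ℤ + N) * (1ℤ + N) * (1ℤ + N + K))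
  ≡ (+ 3 * (+ 3 * N + + 2) * (+ 3 * N + + 4) * (1ℤ + N)) * ((1ℤ + N) * (1ℤ + N) * (1ℤ + N))
      * (a₁ * (1ℤ + N)) * (a₁ * (1ℤ + N)) * (b₁ * ((1ℤ + N) * (1ℤ + (N * + 2 + K) - N))) * y
    - + 8 * ((1ℤ + + 2 * N) * (1ℤ + + 2 * N) * (1ℤ + + 2 * N)) * ((1ℤ + N) * (1ℤ + N) * (1ℤ + N))
      * (1ℤ + N + K) * a * a * b
      * (c * ((1ℤ + (1ℤ + (1ℤ + (N * + 3 + + 1)))) * ((1ℤ + (1ℤ + (N * + 3 + + 1))) * (1ℤ + (N * + 3 + + 1)))))
    - (Q₀ * ((+ 2 * N + + 2 * K + + 2) * (+ 2 * N + + 2 * K + + 3)) * (1ℤ + N) * (1ℤ + N + K)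
         * (a₀ * (1ℤ + N)) * (a₀ * (1ℤ + N)) * b * y
       - Q₁ * (1ℤ + N) * (a₁ * (1ℤ + N)) * (a₁ * (1ℤ + N)) * (b₂ * (1ℤ + (N * + 2 + K) - N))
         * (c₂ * (((1ℤ + N) * + 3 + + 1 - (1ℤ + (1ℤ + N - + 2 * (1ℤ + K))))
                  * ((1ℤ + N) * + 3 + + 1 - (1ℤ + N - + 2 * (1ℤ + K))))))
clear-denominators = ℤ-Solver.solve-∀

cleared-certificate : ∀ N K a b y →
  (+ 3 * (+ 3 * N + + 2) * (+ 3 * N + + 4) * (1ℤ + N)) * ((1ℤ + N) * (1ℤ + N) * (1ℤ + N))
    * (a * (1ℤ + N + K)) * (a * (1ℤ + N + K)) * (b * ((1ℤ + (1ℤ + (N * + 2 + K))) * (1ℤ + (N * + 2 + K)))) * y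
  - + 8 * ((1ℤ + + 2 * N) * (1ℤ + + 2 * N) * (1ℤ + + 2 * N)) * ((1ℤ + N) * (1ℤ + N) * (1ℤ + N))
    * (1ℤ + N + K) * a * a * b
    * (y * ((1ℤ + (N - + 2 * K))
            * ((1ℤ + (1ℤ + (N * + 3 + + 1)) - (N - + 2 * K)) * (1ℤ + (N * + 3 + + 1) - (N - + 2 * K)))))
  - ((+ 22 + + 46 * K + + 125 * N + + 169 * N * K + + 258 * N * N + + 200 * N * N * K
        + + 229 * N * N * N + + 77 * N * N * N * K + + 74 * N * N * N * N)
      * ((+ 2 * N + + 2 * K + + 2) * (+ 2 * N + + 2 * K + + 3)) * (1ℤ + N) * (1ℤ + N + K)
      * (a * (N + K - N)) * (a * (N + K - N)) * b * y
     - (+ 22 + + 46 * (1ℤ + K) + + 125 * N + + 169 * N * (1ℤ + K) + + 258 * N * N + + 200 * N * N * (1ℤ + K)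
        + + 229 * N * N * N + + 77 * N * N * N * (1ℤ + K) + + 74 * N * N * N * N)
      * (1ℤ + N) * (a * (1ℤ + N + K)) * (a * (1ℤ + N + K)) * (b * (1ℤ + (N * + 2 + K)))
      * (y * ((1ℤ + (1ℤ + (1ℤ + N - + 2 * (1ℤ + K)))) * (1ℤ + (1ℤ + N - + 2 * (1ℤ + K))))))
  ≡ 0ℤ
cleared-certificate = ℤ-Solver.solve-∀

-- Primed variables are binomials in the form the shift relations produce them in; the equations
-- y′ ≡ y, y″ ≡ y, a₂ ≡ a₁, b₂ ≡ b₂′ match them with the factors of F and G.
certificate-identity : ∀ n k (M U W a b y y′ y″ a₀ a₁ a₂ b₁ b₂ b₂′ c c₂ : ℤ) →
  M ≡ + n * + 2 + + k → U ≡ + n * + 3 + + 1 → W ≡ (1ℤ + + n) * + 3 + + 1 →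
  y′ ≡ y → y″ ≡ y → a₂ ≡ a₁ → b₂ ≡ b₂′ →
  a₁ * (1ℤ + + n) ≡ a * (1ℤ + + n + + k) →
  a₀ * (1ℤ + + n) ≡ a * (+ n + + k - + n) →
  b₁ * ((1ℤ + + n) * (1ℤ + M - + n)) ≡ b * ((1ℤ + (1ℤ + M)) * (1ℤ + M)) →
  b₂′ * (1ℤ + M - + n) ≡ b * (1ℤ + M) →
  y′ * ((1ℤ + (+ n - + 2 * + k)) * ((1ℤ + (1ℤ + U) - (+ n - + 2 * + k)) * (1ℤ + U - (+ n - + 2 * + k))))
    ≡ c * ((1ℤ + (1ℤ + (1ℤ + U))) * ((1ℤ + (1ℤ + U)) * (1ℤ + U))) →
  y″ * ((1ℤ + (1ℤ + (1ℤ + + n - + 2 * (1ℤ + + k)))) * (1ℤ + (1ℤ + + n - + 2 * (1ℤ + + k))))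
    ≡ c₂ * ((W - (1ℤ + (1ℤ + + n - + 2 * (1ℤ + + k)))) * (W - (1ℤ + + n - + 2 * (1ℤ + + k)))) →
  κ (+ n) * (cube (1ℤ + + n) * (a₁ * a₁ * b₁ * y) - + 8 * cube (1ℤ + + 2 * + n) * (a * a * b * c))
    ≡ q (+ n) (+ k) * ((+ 2 * + n + + 2 * + k + + 2) * (+ 2 * + n + + 2 * + k + + 3)) * (a₀ * a₀ * b * y)
      - q (+ n) (1ℤ + + k) * ((+ 2 * + n + + 2 * (1ℤ + + k) + + 2) * (+ 2 * + n + + 2 * (1ℤ + + k) + + 3))
        * (a₂ * a₂ * b₂ * c₂)
certificate-identity n k _ _ _ a b y _ _ a₀ a₁ _ b₁ _ b₂ c c₂ refl refl refl refl refl refl refl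
                     h-a₁ h-a₀ h-b₁ h-b₂ h-c h-c₂ =
  i-j≡0⇒i≡j _ _ (*-cancelʳ-≡ _ 0ℤ (cube (1ℤ + N) * (1ℤ + N + K))
    (trans (clear-denominators N K a b y a₀ a₁ b₁ b₂ c c₂ (q N K) (q N (1ℤ + K)))
      (trans (substitute h-a₁ h-a₀ h-b₁ h-b₂ (sym h-c) (sym h-c₂))
        (trans (cleared-certificate N K a b y) (sym (*-zeroˡ (cube (1ℤ + N) * (1ℤ + N + K))))))))
  where
    N = + n
    K = + k
    substitute : ∀ {s₁ s₀ r₁ r₂ w w₂ s₁′ s₀′ r₁′ r₂′ w′ w₂′} →
      s₁ ≡ s₁′ → s₀ ≡ s₀′ → r₁ ≡ r₁′ → r₂ ≡ r₂′ → w ≡ w′ → w₂ ≡ w₂′ →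
      clearedDifference N K a b y (q N K) (q N (1ℤ + K)) s₁ s₀ r₁ r₂ w w₂
        ≡ clearedDifference N K a b y (q N K) (q N (1ℤ + K)) s₁′ s₀′ r₁′ r₂′ w′ w₂′
    substitute refl refl refl refl refl refl = refl

pos-linear : ∀ m a b → + (m ℕ.* a ℕ.+ b) ≡ + m * + a + + b
pos-linear m a b = cong (_+ + b) (pos-* m a)

creative-telescoping : ∀ n k →
  κ (+ n) * (cube (1ℤ + + n) * F (suc n) k - + 8 * cube (1ℤ + + 2 * + n) * F n k) ≡ G n k - G n (suc k)
creative-telescoping n k = certificate-identity n k (+ M) (+ U) (+ V) a b y y′ y″ a₀ a₁ a₂ b₁ b₂ b₂′ c c₂
  (pos-linear n 2 k) (pos-linear n 3 1) (pos-linear (suc n) 3 1)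
  (cong (V Cᶻ_) (sym (suc-shift (+ n) (+ k))))
  (cong (V Cᶻ_) (sym (double-suc-shift (+ n) (+ k))))
  (cong (_Cᶻ (+ suc n)) (ℕ.+-suc n k))
  (cong (_Cᶻ (+ n)) (ℕ.+-suc (n ℕ.* 2) k))
  (Cᶻ-absorb (n ℕ.+ k) (+ n))
  (Cᶻ-lower (n ℕ.+ k) (+ n))
  (Cᶻ-absorb-upper M (+ n))
  (Cᶻ-upper M (+ n))
  (Cᶻ-absorb-upper₂ U t)
  (Cᶻ-lower₂ V t₂)
  where
    M = n ℕ.* 2 ℕ.+ k
    U = n ℕ.* 3 ℕ.+ 1
    V = suc n ℕ.* 3 ℕ.+ 1
    t = + n - + 2 * + k
    t₂ = + suc n - + 2 * + suc k
    a = (n ℕ.+ k) Cᶻ (+ n)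
    b = M Cᶻ (+ n)
    c = U Cᶻ t
    a₀ = (n ℕ.+ k) Cᶻ (+ suc n)
    a₁ = (suc n ℕ.+ k) Cᶻ (+ suc n)
    a₂ = (n ℕ.+ suc k) Cᶻ (+ suc n)
    b₁ = (suc n ℕ.* 2 ℕ.+ k) Cᶻ (+ suc n)
    b₂ = (n ℕ.* 2 ℕ.+ suc k) Cᶻ (+ n)
    b₂′ = suc M Cᶻ (+ n)
    y = V Cᶻ (+ suc n - + 2 * + k)
    y′ = V Cᶻ (1ℤ + t)
    y″ = V Cᶻ (1ℤ + (1ℤ + t₂))
    c₂ = V Cᶻ t₂
    suc-shift : ∀ N K → 1ℤ + N - + 2 * K ≡ 1ℤ + (N - + 2 * K)
    suc-shift = ℤ-Solver.solve-∀
    double-suc-shift : ∀ N K → 1ℤ + N - + 2 * K ≡ 1ℤ + (1ℤ + (1ℤ + N - + 2 * (1ℤ + K)))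
    double-suc-shift = ℤ-Solver.solve-∀

G[n,0]≡0 : ∀ n → G n 0 ≡ 0ℤ
G[n,0]≡0 n =
  trans (cong (λ a₀ → Q * (a₀ * a₀ * b * y)) (cong +_ (k>n⇒nCk≡0 (s≤s (ℕ.≤-reflexive (ℕ.+-identityʳ n))))))
    (*-zeroʳ Q)
  where
    Q = q (+ n) (+ 0) * ((+ 2 * + n + + 2 * + 0 + + 2) * (+ 2 * + n + + 2 * + 0 + + 3))
    b = (n ℕ.* 2 ℕ.+ 0) Cᶻ (+ n)
    y = (suc n ℕ.* 3 ℕ.+ 1) Cᶻ (+ suc n - + 2 * + 0)

G[n,2+n]≡0 : ∀ n → G n (2 ℕ.+ n) ≡ 0ℤ
G[n,2+n]≡0 n = trans (cong (λ y → Q * (a₀ * a₀ * b * y)) (cong ((suc n ℕ.* 3 ℕ.+ 1) Cᶻ_) (index (+ n))))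
  (trans (cong (Q *_) (*-zeroʳ (a₀ * a₀ * b))) (*-zeroʳ Q))
  where
    k = 2 ℕ.+ n
    Q = q (+ n) (+ k) * ((+ 2 * + n + + 2 * + k + + 2) * (+ 2 * + n + + 2 * + k + + 3))
    a₀ = (n ℕ.+ k) Cᶻ (+ suc n)
    b = (n ℕ.* 2 ℕ.+ k) Cᶻ (+ n)
    index : ∀ N → 1ℤ + N - + 2 * (1ℤ + (1ℤ + N)) ≡ - (1ℤ + (1ℤ + (1ℤ + N)))
    index = ℤ-Solver.solve-∀

sumToℤ : ℕ → (ℕ → ℤ) → ℤ
sumToℤ zero    f = f zero
sumToℤ (suc m) f = sumToℤ m f + f (suc m)

sumToℤ-telescope : ∀ m (f g : ℕ → ℤ) → (∀ k → f k ≡ g k - g (suc k)) → sumToℤ m f ≡ g 0 - g (suc m)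
sumToℤ-telescope zero    f g eq = eq 0
sumToℤ-telescope (suc m) f g eq =
  trans (cong₂ _+_ (sumToℤ-telescope m f g eq) (eq (suc m))) (collapse (g 0) (g (suc m)) (g (suc (suc m))))
  where
    collapse : ∀ a b c → (a - b) + (b - c) ≡ a - c
    collapse = ℤ-Solver.solve-∀

sumToℤ-linear : ∀ m c α β (f g : ℕ → ℤ) →
  sumToℤ m (λ k → c * (α * f k - β * g k)) ≡ c * (α * sumToℤ m f - β * sumToℤ m g)
sumToℤ-linear zero    c α β f g = refl
sumToℤ-linear (suc m) c α β f g =
  trans (cong (_+ c * (α * f (suc m) - β * g (suc m))) (sumToℤ-linear m c α β f g))
    (distribute c α β (sumToℤ m f) (sumToℤ m g) (f (suc m)) (g (suc m)))
  where
    distribute : ∀ c α β x y u v → c * (α * x - β * y) + c * (α * u - β * v) ≡ c * (α * (x + u) - β * (y + v))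
    distribute = ℤ-Solver.solve-∀

sumToℤ-cong : ∀ m (f g : ℕ → ℤ) → (∀ k → k ≤ m → f k ≡ g k) → sumToℤ m f ≡ sumToℤ m g
sumToℤ-cong zero    f g eq = eq 0 z≤n
sumToℤ-cong (suc m) f g eq =
  cong₂ _+_ (sumToℤ-cong m f g (λ k k≤m → eq k (ℕ.m≤n⇒m≤1+n k≤m))) (eq (suc m) ℕ.≤-refl)

sumToℤ-vanishing-tail : ∀ {b} m (f : ℕ → ℤ) → b ≤ m → (∀ k → b < k → f k ≡ 0ℤ) →
  sumToℤ m f ≡ sumToℤ b f
sumToℤ-vanishing-tail zero    f z≤n   _    = refl
sumToℤ-vanishing-tail (suc m) f b≤1+m vanish with ℕ.m≤n⇒m<n∨m≡n b≤1+m
... | inj₁ b<1+m = trans (cong₂ _+_ (sumToℤ-vanishing-tail m f (ℕ.≤-pred b<1+m) vanish) (vanish (suc m) b<1+m))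
                     (+-identityʳ _)
... | inj₂ refl  = refl

pos-sumTo : ∀ m (f : ℕ → ℕ) → + sumTo m f ≡ sumToℤ m (λ k → + f k)
pos-sumTo zero    f = refl
pos-sumTo (suc m) f = cong (_+ + f (suc m)) (pos-sumTo m f)

summand : ℕ → ℕ → ℕ
summand n k = ((n ℕ.+ k) C n) ℕ.^ 2 ℕ.* ((2 ℕ.* n ℕ.+ k) C n) ℕ.* ((3 ℕ.* n ℕ.+ 1) C (n ℕ.∸ 2 ℕ.* k))

pos-square-product : ∀ a b c → + (a ℕ.^ 2 ℕ.* b ℕ.* c) ≡ + a * + a * + b * + c
pos-square-product a b c = begin
  + (a ℕ.^ 2 ℕ.* b ℕ.* c)   ≡⟨ pos-* (a ℕ.^ 2 ℕ.* b) c ⟩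
  + (a ℕ.^ 2 ℕ.* b) * + c   ≡⟨ cong (_* + c) (pos-* (a ℕ.^ 2) b) ⟩
  + (a ℕ.^ 2) * + b * + c   ≡⟨ cong (λ x → x * + b * + c) (pos-* a (a ℕ.* 1)) ⟩
  + a * + (a ℕ.* 1) * + b * + c ≡⟨ cong (λ x → + a * + x * + b * + c) (ℕ.*-identityʳ a) ⟩
  + a * + a * + b * + c     ∎
  where open ≡-Reasoning

n-2k≡n⊖2k : ∀ n k → + n - + 2 * + k ≡ n ⊖ 2 ℕ.* k
n-2k≡n⊖2k n k = trans (cong (λ x → + n - x) (sym (pos-* 2 k))) (m-n≡m⊖n n (2 ℕ.* k))

F≡summand : ∀ n k → 2 ℕ.* k ≤ n → F n k ≡ + summand n k
F≡summand n k 2k≤n = begin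
  a * a * (n ℕ.* 2 ℕ.+ k) Cᶻ (+ n) * (n ℕ.* 3 ℕ.+ 1) Cᶻ (+ n - + 2 * + k)
    ≡⟨ cong₂ (λ M t → a * a * (M ℕ.+ k) Cᶻ (+ n) * (n ℕ.* 3 ℕ.+ 1) Cᶻ t)
         (ℕ.*-comm n 2) (trans (n-2k≡n⊖2k n k) (⊖-≥ 2k≤n)) ⟩
  a * a * (2 ℕ.* n ℕ.+ k) Cᶻ (+ n) * (n ℕ.* 3 ℕ.+ 1) Cᶻ (+ (n ℕ.∸ 2 ℕ.* k))
    ≡⟨ cong (λ U → a * a * (2 ℕ.* n ℕ.+ k) Cᶻ (+ n) * (U ℕ.+ 1) Cᶻ (+ (n ℕ.∸ 2 ℕ.* k)))
         (ℕ.*-comm n 3) ⟩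
  a * a * (2 ℕ.* n ℕ.+ k) Cᶻ (+ n) * (3 ℕ.* n ℕ.+ 1) Cᶻ (+ (n ℕ.∸ 2 ℕ.* k))
    ≡⟨ pos-square-product ((n ℕ.+ k) C n) ((2 ℕ.* n ℕ.+ k) C n) ((3 ℕ.* n ℕ.+ 1) C (n ℕ.∸ 2 ℕ.* k)) ⟨
  + summand n k ∎
  where
    open ≡-Reasoning
    a = (n ℕ.+ k) Cᶻ (+ n)

F≡0 : ∀ n k → n < 2 ℕ.* k → F n k ≡ 0ℤ
F≡0 n k n<2k = trans
  (cong (λ t → ab * (n ℕ.* 3 ℕ.+ 1) Cᶻ t) (trans (n-2k≡n⊖2k n k) (⊖-< n<2k)))
  (trans (cong (ab *_) (Cᶻ-negative (n ℕ.* 3 ℕ.+ 1) (ℕ.m<n⇒0<n∸m n<2k))) (*-zeroʳ ab))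
  where
    ab = (n ℕ.+ k) Cᶻ (+ n) * (n ℕ.+ k) Cᶻ (+ n) * (n ℕ.* 2 ℕ.+ k) Cᶻ (+ n)

k≤n/2⇒2k≤n : ∀ n k → k ≤ n ℕ./ 2 → 2 ℕ.* k ≤ n
k≤n/2⇒2k≤n n k k≤n/2 = begin
  2 ℕ.* k         ≤⟨ ℕ.*-monoʳ-≤ 2 k≤n/2 ⟩
  2 ℕ.* (n ℕ./ 2) ≡⟨ ℕ.*-comm 2 (n ℕ./ 2) ⟩
  n ℕ./ 2 ℕ.* 2   ≤⟨ m/n*n≤m n 2 ⟩
  n               ∎
  where open ℕ.≤-Reasoning

n/2<k⇒n<2k : ∀ n k → n ℕ./ 2 < k → n < 2 ℕ.* k
n/2<k⇒n<2k n k n/2<k = begin-strict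
  n                             ≡⟨ m≡m%n+[m/n]*n n 2 ⟩
  n ℕ.% 2 ℕ.+ n ℕ./ 2 ℕ.* 2     <⟨ ℕ.+-monoˡ-< (n ℕ./ 2 ℕ.* 2) (m%n<n n 2) ⟩
  suc (n ℕ./ 2) ℕ.* 2           ≤⟨ ℕ.*-monoˡ-≤ 2 n/2<k ⟩
  k ℕ.* 2                       ≡⟨ ℕ.*-comm k 2 ⟩
  2 ℕ.* k                       ∎
  where open ℕ.≤-Reasoning

S : ℕ → ℕ
S n = sumTo (n ℕ./ 2) (summand n)

sumToℤ-F≡S : ∀ n m → n ℕ./ 2 ≤ m → sumToℤ m (F n) ≡ + S n
sumToℤ-F≡S n m n/2≤m = begin
  sumToℤ m (F n)
    ≡⟨ sumToℤ-vanishing-tail m (F n) n/2≤m (λ k n/2<k → F≡0 n k (n/2<k⇒n<2k n k n/2<k)) ⟩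
  sumToℤ (n ℕ./ 2) (F n)
    ≡⟨ sumToℤ-cong (n ℕ./ 2) (F n) (λ k → + summand n k)
         (λ k k≤n/2 → F≡summand n k (k≤n/2⇒2k≤n n k k≤n/2)) ⟩
  sumToℤ (n ℕ./ 2) (λ k → + summand n k)
    ≡⟨ pos-sumTo (n ℕ./ 2) (summand n) ⟨
  + S n ∎
  where open ≡-Reasoning

affine-nonZero : ∀ m a b → NonZero (+ m * + a + + suc b)
affine-nonZero m a b =
  subst NonZero (cong (_+ + suc b) (pos-* m a)) (subst (λ x → NonZero (+ x)) (sym (ℕ.+-suc (m ℕ.* a) b)) _)

κ-nonZero : ∀ n → NonZero (κ (+ n))
κ-nonZero n = i*j≢0 (+ 3 * A * B) (1ℤ + + n)
  {{i*j≢0 (+ 3 * A) B {{i*j≢0 (+ 3) A {{_}} {{affine-nonZero 3 n 1}}}} {{affine-nonZero 3 n 3}}}}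
  where
    A = + 3 * + n + + 2
    B = + 3 * + n + + 4

S-recurrence : ∀ n → cube (1ℤ + + n) * + S (suc n) ≡ + 8 * cube (1ℤ + + 2 * + n) * + S n
S-recurrence n = i-j≡0⇒i≡j _ _ (*-cancelˡ-≡ (κ (+ n)) _ 0ℤ {{κ-nonZero n}} (begin
  κ (+ n) * (α * + S (suc n) - β * + S n)
    ≡⟨ cong₂ (λ u v → κ (+ n) * (α * u - β * v))
         (sumToℤ-F≡S (suc n) (suc n) (m/n≤m (suc n) 2))
         (sumToℤ-F≡S n (suc n) (ℕ.m≤n⇒m≤1+n (m/n≤m n 2))) ⟨
  κ (+ n) * (α * sumToℤ (suc n) (F (suc n)) - β * sumToℤ (suc n) (F n))
    ≡⟨ sumToℤ-linear (suc n) (κ (+ n)) α β (F (suc n)) (F n) ⟨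
  sumToℤ (suc n) (λ k → κ (+ n) * (α * F (suc n) k - β * F n k))
    ≡⟨ sumToℤ-telescope (suc n) _ (G n) (creative-telescoping n) ⟩
  G n 0 - G n (2 ℕ.+ n)
    ≡⟨ cong₂ _-_ (G[n,0]≡0 n) (G[n,2+n]≡0 n) ⟩
  0ℤ
    ≡⟨ *-zeroʳ (κ (+ n)) ⟨
  κ (+ n) * 0ℤ ∎))
  where
    open ≡-Reasoning
    α = cube (1ℤ + + n)
    β = + 8 * cube (1ℤ + + 2 * + n)

central-binomial-ratio : ∀ n →
  (1ℤ + + n) * (suc n ℕ.* 2) Cᶻ (+ suc n) ≡ + 2 * (1ℤ + + 2 * + n) * (n ℕ.* 2) Cᶻ (+ n)
central-binomial-ratio n = *-cancelʳ-≡ _ _ (1ℤ + N) (begin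
  (1ℤ + N) * X * (1ℤ + N)
    ≡⟨ lhs-shape N X ⟩
  X * ((1ℤ + N) * (1ℤ + N * + 2 - N))
    ≡⟨ cong (λ m → X * ((1ℤ + N) * (1ℤ + m - N))) (pos-* n 2) ⟨
  X * ((1ℤ + N) * (1ℤ + + (n ℕ.* 2) - N))
    ≡⟨ Cᶻ-absorb-upper (n ℕ.* 2) N ⟩
  c * ((1ℤ + (1ℤ + + (n ℕ.* 2))) * (1ℤ + + (n ℕ.* 2)))
    ≡⟨ cong (λ m → c * ((1ℤ + (1ℤ + m)) * (1ℤ + m))) (pos-* n 2) ⟩
  c * ((1ℤ + (1ℤ + N * + 2)) * (1ℤ + N * + 2))
    ≡⟨ rhs-shape N c ⟩
  + 2 * (1ℤ + + 2 * N) * c * (1ℤ + N) ∎)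
  where
    open ≡-Reasoning
    N = + n
    X = (suc n ℕ.* 2) Cᶻ (+ suc n)
    c = (n ℕ.* 2) Cᶻ (+ n)
    lhs-shape : ∀ N X → (1ℤ + N) * X * (1ℤ + N) ≡ X * ((1ℤ + N) * (1ℤ + N * + 2 - N))
    lhs-shape = ℤ-Solver.solve-∀
    rhs-shape : ∀ N c → c * ((1ℤ + (1ℤ + N * + 2)) * (1ℤ + N * + 2)) ≡ + 2 * (1ℤ + + 2 * N) * c * (1ℤ + N)
    rhs-shape = ℤ-Solver.solve-∀

R : ℕ → ℕ
R n = ((2 ℕ.* n) C n) ℕ.^ 3

pos-R : ∀ n → + R n ≡ cube ((n ℕ.* 2) Cᶻ (+ n))
pos-R n = begin
  + (c ℕ.* (c ℕ.* (c ℕ.* 1)))     ≡⟨ cong (λ m → + ((m C n) ℕ.^ 3)) (ℕ.*-comm 2 n) ⟩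
  + (c′ ℕ.* (c′ ℕ.* (c′ ℕ.* 1)))  ≡⟨ pos-* c′ (c′ ℕ.* (c′ ℕ.* 1)) ⟩
  + c′ * + (c′ ℕ.* (c′ ℕ.* 1))    ≡⟨ cong (+ c′ *_) (pos-* c′ (c′ ℕ.* 1)) ⟩
  + c′ * (+ c′ * + (c′ ℕ.* 1))    ≡⟨ cong (λ m → + c′ * (+ c′ * + m)) (ℕ.*-identityʳ c′) ⟩
  + c′ * (+ c′ * + c′)            ≡⟨ *-assoc (+ c′) (+ c′) (+ c′) ⟨
  cube (+ c′)                     ∎
  where
    open ≡-Reasoning
    c = (2 ℕ.* n) C n
    c′ = (n ℕ.* 2) C n

R-recurrence : ∀ n → cube (1ℤ + + n) * + R (suc n) ≡ + 8 * cube (1ℤ + + 2 * + n) * + R n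
R-recurrence n = begin
  cube (1ℤ + + n) * + R (suc n)                    ≡⟨ cong (cube (1ℤ + + n) *_) (pos-R (suc n)) ⟩
  cube (1ℤ + + n) * cube X                         ≡⟨ cube-* (1ℤ + + n) X ⟩
  cube ((1ℤ + + n) * X)                            ≡⟨ cong cube (central-binomial-ratio n) ⟩
  cube (+ 2 * (1ℤ + + 2 * + n) * c)                ≡⟨ cube-expand (+ n) c ⟩
  + 8 * cube (1ℤ + + 2 * + n) * cube c             ≡⟨ cong (+ 8 * cube (1ℤ + + 2 * + n) *_) (pos-R n) ⟨
  + 8 * cube (1ℤ + + 2 * + n) * + R n              ∎
  where
    open ≡-Reasoning
    X = (suc n ℕ.* 2) Cᶻ (+ suc n)
    c = (n ℕ.* 2) Cᶻ (+ n)
    cube-* : ∀ a b → a * a * a * (b * b * b) ≡ (a * b) * (a * b) * (a * b)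
    cube-* = ℤ-Solver.solve-∀
    cube-expand : ∀ N c → (+ 2 * (1ℤ + + 2 * N) * c) * (+ 2 * (1ℤ + + 2 * N) * c) * (+ 2 * (1ℤ + + 2 * N) * c)
      ≡ + 8 * ((1ℤ + + 2 * N) * (1ℤ + + 2 * N) * (1ℤ + + 2 * N)) * (c * c * c)
    cube-expand = ℤ-Solver.solve-∀

recurrence-unique : ∀ (p r u v : ℕ → ℤ) → (∀ n → NonZero (p n)) →
  (∀ n → p n * u (suc n) ≡ r n * u n) → (∀ n → p n * v (suc n) ≡ r n * v n) →
  u 0 ≡ v 0 → ∀ n → u n ≡ v n
recurrence-unique p r u v p≢0 rec-u rec-v u₀≡v₀ zero    = u₀≡v₀
recurrence-unique p r u v p≢0 rec-u rec-v u₀≡v₀ (suc n) = *-cancelˡ-≡ (p n) _ _ {{p≢0 n}} (begin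
  p n * u (suc n) ≡⟨ rec-u n ⟩
  r n * u n       ≡⟨ cong (r n *_) (recurrence-unique p r u v p≢0 rec-u rec-v u₀≡v₀ n) ⟩
  r n * v n       ≡⟨ rec-v n ⟨
  p n * v (suc n) ∎)
  where open ≡-Reasoning

mainTheorem8 : (n : ℕ) →
    sumTo (n ℕ./ 2)
      (λ k → ((n ℕ.+ k) C n) ℕ.^ 2 ℕ.* ((2 ℕ.* n ℕ.+ k) C n) ℕ.* ((3 ℕ.* n ℕ.+ 1) C (n ℕ.∸ 2 ℕ.* k)))
      ≡ ((2 ℕ.* n) C n) ℕ.^ 3
mainTheorem8 n = +-injective
  (recurrence-unique (λ m → cube (1ℤ + + m)) (λ m → + 8 * cube (1ℤ + + 2 * + m)) (λ m → + S m) (λ m → + R m)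
     (λ _ → _) S-recurrence R-recurrence refl n)
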